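{- A strong proximity $\vee$-semilattice $(S,0,\vee,\prec)$ is localized if and only if the collection $\mathrm{RIdl}(S)$ of rounded ideals of $S$, ordered by inclusion, is a frame.
   Context: Work constructively. A proximity $\vee$-semilattice is $(S,0,\vee,\prec)$ where $(S,\le,0,\vee)$ is a join-semilattice and $\prec$ a relation on $S$ such that for every $a$: $\{b\mid b\prec a\}$ is a rounded ideal and $\{b\mid a\prec b\}$ is a rounded upward closed set. Here an ideal is a downward closed, inhabited, upward directed subset $I$, and it is rounded if $x\in I\iff\exists y\,(x\prec y\ \&\ y\in I)$; an upward closed $U$ is rounded if $x\in U\iff\exists y\,(y\prec x\ \&\ y\in U)$. It is strong if $a\prec 0\Rightarrow a=0$ and $a\prec b\vee c\Rightarrow\exists b',c'\,(a\le b'\vee c'\ \&\ b'\prec b\ \&\ c'\prec c)$. It is localized if $a\prec b\le c\vee d\Rightarrow\exists a_1\,\exists a_2\,(a_1\prec b\ \&\ a_1\prec c\ \&\ a_2\prec b\ \&\ a_2\prec d\ \&\ a\prec a_1\vee a_2)$. A frame is a poset with finite meets and all joins in which finite meets distribute over all joins. -}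

module Defs where

open import Level using (Level; suc; _⊔_)
open import Data.Product using (Σ; ∃; _×_; proj₁)
open import Relation.Unary using (Pred; _⊆_)
open import Relation.Binary.Core using (Rel)
open import Relation.Binary.Lattice.Bundles using (BoundedJoinSemilattice)

-- Equality of elements is mutual ⊑.

record IsFrame {a r : Level} (ι : Level) (A : Set a) (_⊑_ : Rel A r)
       : Set (a ⊔ r ⊔ suc ι) where
  field
    ⊑-refl   : ∀ {x} → x ⊑ x
    ⊑-trans  : ∀ {x y z} → x ⊑ y → y ⊑ z → x ⊑ z
    top      : A
    top-max  : ∀ x → x ⊑ top
    _∧_      : A → A → A
    ∧-lb₁    : ∀ x y → (x ∧ y) ⊑ x
    ∧-lb₂    : ∀ x y → (x ∧ y) ⊑ y
    ∧-glb    : ∀ {x y z} → z ⊑ x → z ⊑ y → z ⊑ (x ∧ y)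
    ⋁        : {I : Set ι} → (I → A) → A
    ⋁-ub     : {I : Set ι} (f : I → A) (i : I) → f i ⊑ ⋁ f
    ⋁-lub    : {I : Set ι} (f : I → A) {z : A} → (∀ i → f i ⊑ z) → ⋁ f ⊑ z
    distrib₁ : (x : A) {I : Set ι} (f : I → A) → (x ∧ ⋁ f) ⊑ ⋁ (λ i → x ∧ f i)
    distrib₂ : (x : A) {I : Set ι} (f : I → A) → ⋁ (λ i → x ∧ f i) ⊑ (x ∧ ⋁ f)

module _ {ℓ : Level} (L : BoundedJoinSemilattice ℓ ℓ ℓ) where
  open BoundedJoinSemilattice L

  DownClosed : Pred Carrier ℓ → Set ℓ
  DownClosed U = ∀ {x y} → x ≤ y → U y → U x

  UpClosed : Pred Carrier ℓ → Set ℓ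
  UpClosed U = ∀ {x y} → x ≤ y → U x → U y

  Inhabited : Pred Carrier ℓ → Set ℓ
  Inhabited U = ∃ λ x → U x

  UpDirected : Pred Carrier ℓ → Set ℓ
  UpDirected U = ∀ {x y} → U x → U y → ∃ λ z → U z × x ≤ z × y ≤ z

  IsIdeal : Pred Carrier ℓ → Set ℓ
  IsIdeal U = DownClosed U × Inhabited U × UpDirected U

  module _ (_≺_ : Rel Carrier ℓ) where

    RoundedIdealCond : Pred Carrier ℓ → Set ℓ
    RoundedIdealCond U = ∀ x → (U x → ∃ λ y → x ≺ y × U y)
                             × ((∃ λ y → x ≺ y × U y) → U x)

    RoundedUpperCond : Pred Carrier ℓ → Set ℓ
    RoundedUpperCond U = ∀ x → (U x → ∃ λ y → y ≺ x × U y)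
                             × ((∃ λ y → y ≺ x × U y) → U x)

    IsRoundedIdeal : Pred Carrier ℓ → Set ℓ
    IsRoundedIdeal U = IsIdeal U × RoundedIdealCond U

    IsRoundedUpper : Pred Carrier ℓ → Set ℓ
    IsRoundedUpper U = UpClosed U × RoundedUpperCond U

record ProximityJoinSemilattice (ℓ : Level) : Set (suc ℓ) where
  field
    semilattice : BoundedJoinSemilattice ℓ ℓ ℓ
  open BoundedJoinSemilattice semilattice public
  field
    _≺_       : Rel Carrier ℓ
    below-rid : ∀ a → IsRoundedIdeal semilattice _≺_ (λ b → b ≺ a)
    above-rup : ∀ a → IsRoundedUpper semilattice _≺_ (λ b → a ≺ b)

module _ {ℓ : Level} (S : ProximityJoinSemilattice ℓ) where
  open ProximityJoinSemilattice S

  IsStrong : Set ℓ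
  IsStrong = (∀ {a} → a ≺ ⊥ → a ≈ ⊥)
           × (∀ {a b c} → a ≺ (b ∨ c) →
                ∃ λ b′ → ∃ λ c′ → a ≤ (b′ ∨ c′) × b′ ≺ b × c′ ≺ c)

  IsLocalized : Set ℓ
  IsLocalized = ∀ {a b c d} → a ≺ b → b ≤ (c ∨ d) →
    ∃ λ a₁ → ∃ λ a₂ → a₁ ≺ b × a₁ ≺ c × a₂ ≺ b × a₂ ≺ d × a ≺ (a₁ ∨ a₂)

  RIdl : Set (suc ℓ)
  RIdl = Σ (Pred Carrier ℓ) (IsRoundedIdeal semilattice _≺_)

  _⊑R_ : Rel RIdl ℓ
  I ⊑R J = proj₁ I ⊆ proj₁ J

  RIdlIsFrame : Set (suc ℓ)
  RIdlIsFrame = IsFrame ℓ RIdl _⊑R_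

-- The rounding {x | ∃ y ∈ Q. x ≺ y} of any set Q containing ⊥ and closed under ∨ is a
-- rounded ideal, so meets, joins and the top of RIdl(S) are roundings of intersections,
-- of the ∨-closure of a union, and of S itself.  Distributivity then reduces to: if
-- a ≺ y ∈ I and y ≺ w for w in the ∨-closure of ⋃ Jᵢ, then a lies in ⋁ (I ∧ Jᵢ); this
-- goes by induction on how w is generated, where strongness splits y ≺ w₁ ∨ w₂ and
-- localization splits a ≺ y into pieces below y and below the two halves.  Conversely,
-- given a ≺ b ≤ c ∨ d, the element a lies in ↓b ∧ (↓c ∨ ↓d), and frame distributivity
-- puts it in (↓b ∧ ↓c) ∨ (↓b ∧ ↓d), which lies inside the rounding of the set of all
-- a₁ ∨ a₂ with a₁ ≺ b, c and a₂ ≺ b, d.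
module Submission where

open import Defs
open import Level using (Level; Lift; lift)
open import Data.Bool using (Bool; true; false)
open import Data.Product using (_×_; _,_; proj₁; proj₂; ∃)
open import Data.Unit.Polymorphic using (⊤; tt)
open import Relation.Unary using (Pred; _⊆_; _∩_)
open import Relation.Binary.Core using (Rel)
import Relation.Binary.Lattice.Properties.JoinSemilattice as JoinSemilatticeProperties

module _ {ℓ : Level} (S : ProximityJoinSemilattice ℓ) where
  open ProximityJoinSemilattice S
  open JoinSemilatticeProperties joinSemilattice using (∨-monotonic)

  ≤-≺-trans : ∀ {x y z} → x ≤ y → y ≺ z → x ≺ z
  ≤-≺-trans x≤y y≺z = proj₁ (proj₁ (below-rid _)) x≤y y≺z

  ≺-≤-trans : ∀ {x y z} → x ≺ y → y ≤ z → x ≺ z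
  ≺-≤-trans {x} x≺y y≤z = proj₁ (above-rup x) y≤z x≺y

  ≺-trans : ∀ {x y z} → x ≺ y → y ≺ z → x ≺ z
  ≺-trans {x} {y} {z} x≺y y≺z = proj₂ (proj₂ (below-rid z) x) (y , x≺y , y≺z)

  ≺-interpolate : ∀ {x z} → x ≺ z → ∃ λ y → x ≺ y × y ≺ z
  ≺-interpolate {x} {z} = proj₁ (proj₂ (below-rid z) x)

  ⊥-≺ : ∀ {z} → ⊥ ≺ z
  ⊥-≺ {z} with proj₁ (proj₂ (proj₁ (below-rid z)))
  ... | w , w≺z = ≤-≺-trans (minimum w) w≺z

  ∨-≺ : ∀ {x y z} → x ≺ z → y ≺ z → (x ∨ y) ≺ z
  ∨-≺ x≺z y≺z with proj₂ (proj₂ (proj₁ (below-rid _))) x≺z y≺z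
  ... | u , u≺z , x≤u , y≤u = ≤-≺-trans (∨-least x≤u y≤u) u≺z

  ∨-mono-≺ : ∀ {x y x′ y′} → x ≺ x′ → y ≺ y′ → (x ∨ y) ≺ (x′ ∨ y′)
  ∨-mono-≺ x≺x′ y≺y′ = ∨-≺ (≺-≤-trans x≺x′ (x≤x∨y _ _)) (≺-≤-trans y≺y′ (y≤x∨y _ _))

  ∨-interchange-≤ : ∀ {p q p′ q′} → ((p ∨ q) ∨ (p′ ∨ q′)) ≤ ((p ∨ p′) ∨ (q ∨ q′))
  ∨-interchange-≤ = ∨-least (∨-monotonic (x≤x∨y _ _) (x≤x∨y _ _))
                            (∨-monotonic (y≤x∨y _ _) (y≤x∨y _ _))

  infix 4 _∈_ _⊑_
  infix 25 ↓_

  _∈_ : Carrier → RIdl S → Set ℓ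
  x ∈ I = proj₁ I x

  _⊑_ : Rel (RIdl S) ℓ
  _⊑_ = _⊑R_ S

  module RoundedIdeal (I : RIdl S) where

    ∈-downward : ∀ {x y} → x ≤ y → y ∈ I → x ∈ I
    ∈-downward = proj₁ (proj₁ (proj₂ I))

    ⊥-∈ : ⊥ ∈ I
    ⊥-∈ with proj₁ (proj₂ (proj₁ (proj₂ I)))
    ... | w , w∈I = ∈-downward (minimum w) w∈I

    ∨-∈ : ∀ {x y} → x ∈ I → y ∈ I → (x ∨ y) ∈ I
    ∨-∈ x∈I y∈I with proj₂ (proj₂ (proj₁ (proj₂ I))) x∈I y∈I
    ... | u , u∈I , x≤u , y≤u = ∈-downward (∨-least x≤u y≤u) u∈I

    ∈-rounded : ∀ {x} → x ∈ I → ∃ λ y → x ≺ y × y ∈ I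
    ∈-rounded {x} = proj₁ (proj₂ (proj₂ I) x)

    ≺-∈ : ∀ {x y} → x ≺ y → y ∈ I → x ∈ I
    ≺-∈ {x} {y} x≺y y∈I = proj₂ (proj₂ (proj₂ I) x) (y , x≺y , y∈I)

  open RoundedIdeal

  ↓_ : Carrier → RIdl S
  ↓ a = (λ b → b ≺ a) , below-rid a

  IsJoinClosed : Pred Carrier ℓ → Set ℓ
  IsJoinClosed Q = Q ⊥ × (∀ {x y} → Q x → Q y → Q (x ∨ y))

  Rounding : Pred Carrier ℓ → Pred Carrier ℓ
  Rounding Q x = ∃ λ y → x ≺ y × Q y

  rounding : (Q : Pred Carrier ℓ) → IsJoinClosed Q → RIdl S
  rounding Q (Q⊥ , Q∨) = Rounding Q , (downward , (⊥ , ⊥ , ⊥-≺ , Q⊥) , directed) , rounded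
    where
    downward : DownClosed semilattice (Rounding Q)
    downward x≤x′ (y , x′≺y , Qy) = y , ≤-≺-trans x≤x′ x′≺y , Qy

    directed : UpDirected semilattice (Rounding Q)
    directed {x} {x′} (y , x≺y , Qy) (y′ , x′≺y′ , Qy′) =
      x ∨ x′ , (y ∨ y′ , ∨-mono-≺ x≺y x′≺y′ , Q∨ Qy Qy′) , x≤x∨y _ _ , y≤x∨y _ _

    rounded : RoundedIdealCond semilattice _≺_ (Rounding Q)
    rounded x = split , λ { (z , x≺z , y , z≺y , Qy) → y , ≺-trans x≺z z≺y , Qy }
      where
      split : Rounding Q x → ∃ λ z → x ≺ z × Rounding Q z
      split (y , x≺y , Qy) with ≺-interpolate x≺y
      ... | z , x≺z , z≺y = z , x≺z , y , z≺y , Qy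

  Rounding-⊆ : ∀ {Q} (I : RIdl S) → Q ⊆ proj₁ I → Rounding Q ⊆ proj₁ I
  Rounding-⊆ I Q⊆I (y , x≺y , Qy) = ≺-∈ I x≺y (Q⊆I Qy)

  ⊆-Rounding : ∀ {Q} (I : RIdl S) → proj₁ I ⊆ Q → proj₁ I ⊆ Rounding Q
  ⊆-Rounding I I⊆Q x∈I with ∈-rounded I x∈I
  ... | y , x≺y , y∈I = y , x≺y , I⊆Q y∈I

  ∈-joinClosed : (I : RIdl S) → IsJoinClosed (proj₁ I)
  ∈-joinClosed I = ⊥-∈ I , ∨-∈ I

  ∩-joinClosed : ∀ {P Q} → IsJoinClosed P → IsJoinClosed Q → IsJoinClosed (P ∩ Q)
  ∩-joinClosed (P⊥ , P∨) (Q⊥ , Q∨) =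
    (P⊥ , Q⊥) , λ (Px , Qx) (Py , Qy) → P∨ Px Py , Q∨ Qx Qy

  ≺-joinClosed : ∀ a → IsJoinClosed (_≺ a)
  ≺-joinClosed a = ⊥-≺ , ∨-≺

  _⊕_ : Pred Carrier ℓ → Pred Carrier ℓ → Pred Carrier ℓ
  (P ⊕ Q) v = ∃ λ p → ∃ λ q → P p × Q q × v ≤ (p ∨ q)

  ⊕-joinClosed : ∀ {P Q} → IsJoinClosed P → IsJoinClosed Q → IsJoinClosed (P ⊕ Q)
  ⊕-joinClosed (P⊥ , P∨) (Q⊥ , Q∨) =
    (⊥ , ⊥ , P⊥ , Q⊥ , minimum _) ,
    λ (p , q , Pp , Qq , v≤) (p′ , q′ , Pp′ , Qq′ , v′≤) →
      p ∨ p′ , q ∨ q′ , P∨ Pp Pp′ , Q∨ Qq Qq′ , trans (∨-monotonic v≤ v′≤) ∨-interchange-≤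

  data Generated {J : Set ℓ} (f : J → RIdl S) : Pred Carrier ℓ where
    generator : ∀ {x} (j : J) → x ∈ f j → Generated f x
    bottom    : Generated f ⊥
    below-∨   : ∀ {x y z} → Generated f y → Generated f z → x ≤ (y ∨ z) → Generated f x

  Generated-joinClosed : {J : Set ℓ} (f : J → RIdl S) → IsJoinClosed (Generated f)
  Generated-joinClosed f = bottom , λ gx gy → below-∨ gx gy refl

  Generated-least : {J : Set ℓ} (f : J → RIdl S) (K : RIdl S) →
                    (∀ j → f j ⊑ K) → Generated f ⊆ proj₁ K
  Generated-least f K fⱼ⊑K (generator j x∈fⱼ) = fⱼ⊑K j x∈fⱼ
  Generated-least f K fⱼ⊑K bottom             = ⊥-∈ K
  Generated-least f K fⱼ⊑K (below-∨ gy gz x≤) =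
    ∈-downward K x≤ (∨-∈ K (Generated-least f K fⱼ⊑K gy) (Generated-least f K fⱼ⊑K gz))

  ⊤ᴿ : RIdl S
  ⊤ᴿ = rounding (λ _ → ⊤) (tt , λ _ _ → tt)

  _∧ᴿ_ : RIdl S → RIdl S → RIdl S
  I ∧ᴿ J = rounding (proj₁ I ∩ proj₁ J) (∩-joinClosed (∈-joinClosed I) (∈-joinClosed J))

  ⋁ᴿ : {J : Set ℓ} → (J → RIdl S) → RIdl S
  ⋁ᴿ f = rounding (Generated f) (Generated-joinClosed f)

  ∧ᴿ-lb₁ : ∀ I J → (I ∧ᴿ J) ⊑ I
  ∧ᴿ-lb₁ I J = Rounding-⊆ I proj₁

  ∧ᴿ-lb₂ : ∀ I J → (I ∧ᴿ J) ⊑ J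
  ∧ᴿ-lb₂ I J = Rounding-⊆ J proj₂

  ∧ᴿ-glb : ∀ {I J K} → K ⊑ I → K ⊑ J → K ⊑ (I ∧ᴿ J)
  ∧ᴿ-glb {K = K} K⊑I K⊑J = ⊆-Rounding K λ x∈K → K⊑I x∈K , K⊑J x∈K

  ⋁ᴿ-ub : {J : Set ℓ} (f : J → RIdl S) (j : J) → f j ⊑ ⋁ᴿ f
  ⋁ᴿ-ub f j = ⊆-Rounding (f j) (generator j)

  ⋁ᴿ-lub : {J : Set ℓ} (f : J → RIdl S) {K : RIdl S} → (∀ j → f j ⊑ K) → ⋁ᴿ f ⊑ K
  ⋁ᴿ-lub f {K} fⱼ⊑K = Rounding-⊆ K (Generated-least f K fⱼ⊑K)

  ⋁ᴿ-∧ᴿ-⊑ : (I : RIdl S) {J : Set ℓ} (f : J → RIdl S) → ⋁ᴿ (λ j → I ∧ᴿ f j) ⊑ (I ∧ᴿ ⋁ᴿ f)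
  ⋁ᴿ-∧ᴿ-⊑ I {J} f = ∧ᴿ-glb {I} {⋁ᴿ f} {⋁ᴿ I∧f}
    (⋁ᴿ-lub I∧f {I} λ j → ∧ᴿ-lb₁ I (f j))
    (⋁ᴿ-lub I∧f {⋁ᴿ f} λ j x∈ → ⋁ᴿ-ub f j (∧ᴿ-lb₂ I (f j) x∈))
    where
    I∧f : J → RIdl S
    I∧f j = I ∧ᴿ f j

  module _ (strong : IsStrong S) where

    ≺-⊥ : ∀ {a} → a ≺ ⊥ → a ≈ ⊥
    ≺-⊥ = proj₁ strong

    ≺-∨-split : ∀ {a b c} → a ≺ (b ∨ c) → ∃ λ b′ → ∃ λ c′ → a ≤ (b′ ∨ c′) × b′ ≺ b × c′ ≺ c
    ≺-∨-split = proj₂ strong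

    module _ (localized : IsLocalized S) (I : RIdl S) {J : Set ℓ} (f : J → RIdl S) where

      ≺-generated-∈-⋁ᴿ-∧ᴿ : ∀ {w} → Generated f w → ∀ {a y} → a ≺ y → y ∈ I → y ≺ w →
                            a ∈ ⋁ᴿ (λ j → I ∧ᴿ f j)
      ≺-generated-∈-⋁ᴿ-∧ᴿ (generator j w∈fⱼ) {y = y} a≺y y∈I y≺w =
        ⋁ᴿ-ub _ j (y , a≺y , y∈I , ≺-∈ (f j) y≺w w∈fⱼ)
      ≺-generated-∈-⋁ᴿ-∧ᴿ bottom a≺y y∈I y≺⊥ =
        ⊥ , ≺-≤-trans a≺y (reflexive (≺-⊥ y≺⊥)) , bottom
      ≺-generated-∈-⋁ᴿ-∧ᴿ (below-∨ g₁ g₂ w≤) {a} a≺y y∈I y≺w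
        with ≺-∨-split (≺-≤-trans y≺w w≤)
      ... | b′ , c′ , y≤ , b′≺w₁ , c′≺w₂
        with localized a≺y y≤
      ... | a₁ , a₂ , a₁≺y , a₁≺b′ , a₂≺y , a₂≺c′ , a≺a₁∨a₂
        with ≺-∨-split a≺a₁∨a₂
      ... | a₁′ , a₂′ , a≤ , a₁′≺a₁ , a₂′≺a₂ =
        ∈-downward ⋁∧ a≤ (∨-∈ ⋁∧
          (≺-generated-∈-⋁ᴿ-∧ᴿ g₁ a₁′≺a₁ (≺-∈ I a₁≺y y∈I) (≺-trans a₁≺b′ b′≺w₁))
          (≺-generated-∈-⋁ᴿ-∧ᴿ g₂ a₂′≺a₂ (≺-∈ I a₂≺y y∈I) (≺-trans a₂≺c′ c′≺w₂)))
        where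
        ⋁∧ : RIdl S
        ⋁∧ = ⋁ᴿ (λ j → I ∧ᴿ f j)

      ∧ᴿ-⋁ᴿ-⊑ : (I ∧ᴿ ⋁ᴿ f) ⊑ ⋁ᴿ (λ j → I ∧ᴿ f j)
      ∧ᴿ-⋁ᴿ-⊑ (y , x≺y , y∈I , w , y≺w , gw) = ≺-generated-∈-⋁ᴿ-∧ᴿ gw x≺y y∈I y≺w

    localized⇒frame : IsLocalized S → RIdlIsFrame S
    localized⇒frame localized = record
      { ⊑-refl   = λ x∈I → x∈I
      ; ⊑-trans  = λ I⊑J J⊑K x∈I → J⊑K (I⊑J x∈I)
      ; top      = ⊤ᴿ
      ; top-max  = λ I → ⊆-Rounding I (λ _ → tt)
      ; _∧_      = _∧ᴿ_
      ; ∧-lb₁    = ∧ᴿ-lb₁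
      ; ∧-lb₂    = ∧ᴿ-lb₂
      ; ∧-glb    = λ {I} {J} {K} → ∧ᴿ-glb {I} {J} {K}
      ; ⋁        = ⋁ᴿ
      ; ⋁-ub     = ⋁ᴿ-ub
      ; ⋁-lub    = ⋁ᴿ-lub
      ; distrib₁ = λ I f → ∧ᴿ-⋁ᴿ-⊑ localized I f
      ; distrib₂ = ⋁ᴿ-∧ᴿ-⊑
      }

    ↓-∨-⊑ : ∀ {c d} (K : RIdl S) → ↓ c ⊑ K → ↓ d ⊑ K → ↓ (c ∨ d) ⊑ K
    ↓-∨-⊑ K ↓c⊑K ↓d⊑K x≺c∨d with ≺-∨-split x≺c∨d
    ... | c′ , d′ , x≤ , c′≺c , d′≺d = ∈-downward K x≤ (∨-∈ K (↓c⊑K c′≺c) (↓d⊑K d′≺d))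

    frame⇒localized : RIdlIsFrame S → IsLocalized S
    frame⇒localized F {a} {b} {c} {d} a≺b b≤c∨d
      with ⋁-lub (λ i → ↓ b ∧ ↓cd i) {localizing} below-localizing
             (distrib₁ (↓ b) ↓cd (↓b⊑↓b∧⋁↓cd a≺b))
      where
      open IsFrame F

      ↓cd : Lift ℓ Bool → RIdl S
      ↓cd (lift true)  = ↓ c
      ↓cd (lift false) = ↓ d

      ↓b⊑↓b∧⋁↓cd : ↓ b ⊑ (↓ b ∧ ⋁ ↓cd)
      ↓b⊑↓b∧⋁↓cd = ∧-glb {↓ b} {⋁ ↓cd} {↓ b} (λ x≺b → x≺b)
        (λ x≺b → ↓-∨-⊑ (⋁ ↓cd) (⋁-ub ↓cd (lift true)) (⋁-ub ↓cd (lift false))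
                   (≺-≤-trans x≺b b≤c∨d))

      localizing : RIdl S
      localizing = rounding (((_≺ b) ∩ (_≺ c)) ⊕ ((_≺ b) ∩ (_≺ d)))
        (⊕-joinClosed (∩-joinClosed (≺-joinClosed b) (≺-joinClosed c))
                      (∩-joinClosed (≺-joinClosed b) (≺-joinClosed d)))

      below-localizing : ∀ i → (↓ b ∧ ↓cd i) ⊑ localizing
      below-localizing (lift true) = ⊆-Rounding (↓ b ∧ ↓ c) λ {y} y∈ →
        y , ⊥ , (∧-lb₁ (↓ b) (↓ c) y∈ , ∧-lb₂ (↓ b) (↓ c) y∈) , (⊥-≺ , ⊥-≺) , x≤x∨y _ _
      below-localizing (lift false) = ⊆-Rounding (↓ b ∧ ↓ d) λ {y} y∈ →
        ⊥ , y , (⊥-≺ , ⊥-≺) , (∧-lb₁ (↓ b) (↓ d) y∈ , ∧-lb₂ (↓ b) (↓ d) y∈) , y≤x∨y _ _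
    ... | v , a≺v , a₁ , a₂ , (a₁≺b , a₁≺c) , (a₂≺b , a₂≺d) , v≤a₁∨a₂ =
      a₁ , a₂ , a₁≺b , a₁≺c , a₂≺b , a₂≺d , ≺-≤-trans a≺v v≤a₁∨a₂

proposition3p34 : {ℓ : Level} (S : ProximityJoinSemilattice ℓ) → IsStrong S →
    (IsLocalized S → RIdlIsFrame S) × (RIdlIsFrame S → IsLocalized S)
proposition3p34 S strong = localized⇒frame S strong , frame⇒localized S strong
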